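{- Let $n$ be an even positive integer with prime factorization $n=2^e q_1^{e_1}\cdots q_l^{e_l}$ ($e\ge 1$, $q_1,\ldots,q_l$ distinct odd primes, $e_i\ge 1$), and let $r$ be an integer. If $S_{2^e-1}\equiv r\pmod{2^e}$ and $S_{q_i^{e_i}-1}\equiv -r\pmod{q_i^{e_i}}$ for all $i=1,\ldots,l$, then $S_{n-1}\equiv r\pmod n$.
   Context: The derangement numbers are $S_k=k!\sum_{i=0}^{k}\frac{(-1)^i}{i!}$ for $k\ge 0$. -}

module Defs where

open import Data.Nat using (ℕ; zero; suc; _!; _/_; NonZero)
open import Data.Nat.Properties using (_!≢0)
open import Data.Fin using (Fin)
import Data.Integer as ℤ
open import Data.Integer using (ℤ; +_; -_)
open import Data.Integer.Divisibility using (_∣_)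

sumTo : ℕ → (ℕ → ℤ) → ℤ
sumTo zero    f = f zero
sumTo (suc k) f = sumTo k f ℤ.+ f (suc k)

sign : ℕ → ℤ
sign zero    = + 1
sign (suc i) = - sign i

-- Derangement number S_k = k! Σ_{i=0}^k (-1)^i / i! = Σ_{i=0}^k (-1)^i (k!/i!)
-- (k!/i! is an exact natural-number quotient for i ≤ k).
S : ℕ → ℤ
S k = sumTo k (λ i → sign i ℤ.* (+ (_/_ (k !) (i !) {{i !≢0}})))

_≡_[mod_] : ℤ → ℤ → ℤ → Set
a ≡ b [mod m ] = m ∣ (a ℤ.- b)

prodFin : (l : ℕ) → (Fin l → ℕ) → ℕ
prodFin zero    f = 1
prodFin (suc l) f = f Fin.zero Data.Nat.* prodFin l (λ i → f (Fin.suc i))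
  where import Data.Fin as Fin

module Submission where

-- The derangement numbers satisfy  S_{k+1} = (k+1) S_k + (-1)^{k+1},
-- and from this recurrence one obtains the periodicity
--     S_{k+m} ≡ (-1)^m S_k   (mod m),
-- hence  S_{k+jm} ≡ (-1)^{jm} S_k (mod m).  Taking k = m-1 shows that for every
-- positive divisor m of n,
--     S_{n-1} ≡ (-1)^{n-m} S_{m-1}   (mod m),
-- so S_{n-1} ≡ S_{m-1} (mod m) if m is even, and S_{n-1} ≡ -S_{m-1} (mod m) if m
-- is odd and n is even.  Applied to m = 2^e and to m = q_i^{e_i} these give
-- S_{n-1} ≡ r modulo every prime-power factor of n; since those factors are
-- pairwise coprime their product n divides S_{n-1} - r (Chinese remainder step).

open import Defs
open import Data.Nat using (ℕ; _*_; _^_; _≤_)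
open import Data.Nat.Divisibility using (_∣_)
open import Data.Nat.Primality using (Prime)
open import Data.Fin using (Fin)
open import Data.Integer using (ℤ; +_; -_)
open import Data.Nat.Base using (_∸_)
open import Function.Definitions using (Injective)
open import Relation.Binary.PropositionalEquality using (_≡_)
open import Relation.Nullary using (¬_)

open import Data.Nat.Base using (zero; suc; _+_; _!; NonZero; z≤n)
open import Data.Nat.Properties using (_!≢0; *-comm; *-assoc; +-identityʳ; +-comm; +-assoc; m≤n⇒m≤1+n; ≤-refl; m*n≢0; m^n≢0)
open import Data.Nat.DivMod using (_/_; *-/-assoc; n/n≡1)
open import Data.Nat.Divisibility
  using (divides; ∣-refl; ∣-trans; m∣m*n; ∣m⇒∣m*n; ∣n⇒∣m*n; ∣m+n∣m⇒∣n; m≤n⇒m!∣n!; ∣1⇒≡1; 1∣_)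
open import Data.Nat.Coprimality using (Coprime; coprime-divisor)
import Data.Nat.Coprimality as Coprime
open import Data.Nat.Primality using (prime[2]; prime⇒irreducible; prime⇒nonZero)
import Data.Fin as Fin
import Data.Fin.Properties as Fin
import Data.Integer as ℤ
import Data.Integer.Properties as ℤ
import Data.Integer.Divisibility.Signed as Signed
open import Data.Integer.Tactic.RingSolver using (solve-∀)
open import Algebra.Properties.CommutativeSemigroup ℤ.*-commutativeSemigroup using (x∙yz≈y∙xz)
open import Data.Product using (_,_)
open import Function.Base using (_∘_)
open import Data.Sum using (_⊎_; inj₁; inj₂)
open import Data.Empty using (⊥-elim)
open import Relation.Binary.PropositionalEquality
  using (refl; sym; trans; cong; cong₂; subst; _≢_; module ≡-Reasoning)
open ≡-Reasoning

sumTo-cong : ∀ k {f g : ℕ → ℤ} → (∀ {i} → i ≤ k → f i ≡ g i) → sumTo k f ≡ sumTo k g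
sumTo-cong zero    f≗g = f≗g z≤n
sumTo-cong (suc k) f≗g =
  cong₂ ℤ._+_ (sumTo-cong k (λ i≤k → f≗g (m≤n⇒m≤1+n i≤k))) (f≗g ≤-refl)

sumTo-*ˡ : ∀ k c (f : ℕ → ℤ) → sumTo k (λ i → c ℤ.* f i) ≡ c ℤ.* sumTo k f
sumTo-*ˡ zero    c f = refl
sumTo-*ˡ (suc k) c f = begin
  sumTo k (λ i → c ℤ.* f i) ℤ.+ c ℤ.* f (suc k) ≡⟨ cong (ℤ._+ c ℤ.* f (suc k)) (sumTo-*ˡ k c f) ⟩
  c ℤ.* sumTo k f ℤ.+ c ℤ.* f (suc k)           ≡⟨ ℤ.*-distribˡ-+ c (sumTo k f) (f (suc k)) ⟨
  c ℤ.* (sumTo k f ℤ.+ f (suc k))               ∎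

-- The derangement recurrence  S_{k+1} = (k+1) S_k + (-1)^{k+1}: every term of
-- S_{k+1} except the last is (k+1) times the corresponding term of S_k.
S-suc : ∀ k → S (suc k) ≡ + suc k ℤ.* S k ℤ.+ sign (suc k)
S-suc k = cong₂ ℤ._+_ (trans (sumTo-cong k scaled-term) (sumTo-*ˡ k (+ suc k) _)) last-term
  where
  scaled-term : ∀ {i} → i ≤ k →
    sign i ℤ.* + (_/_ (suc k !) (i !) {{i !≢0}}) ≡ + suc k ℤ.* (sign i ℤ.* + (_/_ (k !) (i !) {{i !≢0}}))
  scaled-term {i} i≤k = begin
    sign i ℤ.* + (suc k * k ! / i !)        ≡⟨ cong (λ x → sign i ℤ.* + x) (*-/-assoc (suc k) (m≤n⇒m!∣n! i≤k)) ⟩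
    sign i ℤ.* + (suc k * (k ! / i !))      ≡⟨ cong (sign i ℤ.*_) (ℤ.pos-* (suc k) (k ! / i !)) ⟩
    sign i ℤ.* (+ suc k ℤ.* + (k ! / i !))  ≡⟨ x∙yz≈y∙xz (sign i) (+ suc k) (+ (k ! / i !)) ⟩
    + suc k ℤ.* (sign i ℤ.* + (k ! / i !))  ∎
    where instance _ = i !≢0
  last-term : sign (suc k) ℤ.* + (_/_ (suc k !) (suc k !) {{suc k !≢0}}) ≡ sign (suc k)
  last-term = trans (cong (λ x → sign (suc k) ℤ.* + x) (n/n≡1 (suc k !) {{suc k !≢0}}))
                    (ℤ.*-identityʳ (sign (suc k)))

sign-+ : ∀ a b → sign (a + b) ≡ sign a ℤ.* sign b
sign-+ zero    b = sym (ℤ.*-identityˡ (sign b))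
sign-+ (suc a) b = trans (cong -_ (sign-+ a b)) (ℤ.neg-distribˡ-* (sign a) (sign b))

sign-even : ∀ {k} → 2 ∣ k → sign k ≡ + 1
sign-even (divides j refl) = sign-double j
  where
  sign-double : ∀ j → sign (j * 2) ≡ + 1
  sign-double zero    = refl
  sign-double (suc j) = trans (ℤ.neg-involutive (sign (j * 2))) (sign-double j)

even-or-odd : ∀ k → 2 ∣ k ⊎ 2 ∣ suc k
even-or-odd zero = inj₁ (divides 0 refl)
even-or-odd (suc k) with even-or-odd k
... | inj₁ (divides j refl) = inj₂ (divides (suc j) refl)
... | inj₂ 2∣1+k            = inj₁ 2∣1+k

sign-odd : ∀ {k} → ¬ 2 ∣ k → sign k ≡ - + 1
sign-odd {k} 2∤k with even-or-odd k
... | inj₁ 2∣k   = ⊥-elim (2∤k 2∣k)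
... | inj₂ 2∣1+k = trans (sym (ℤ.neg-involutive (sign k))) (cong -_ (sign-even 2∣1+k))

-- Unlike _≡_[mod_] of Defs, which unfolds to a statement about
-- absolute values, this record keeps m, a and b inferable, and the signed
-- divisibility relation has the closure properties used below.
record Congruent (m a b : ℤ) : Set where
  constructor congruent
  field difference : m Signed.∣ (a ℤ.- b)

open Congruent

fromMod : ∀ m a b → a ≡ b [mod m ] → Congruent m a b
fromMod m a b a≡b = congruent (Signed.∣ᵤ⇒∣ {m} {a ℤ.- b} a≡b)

toMod : ∀ {m a b} → Congruent m a b → a ≡ b [mod m ]
toMod a≡b = Signed.∣⇒∣ᵤ (difference a≡b)

mod-reflexive : ∀ {m a b} → a ≡ b → Congruent m a b
mod-reflexive {a = a} refl =
  congruent (Signed.divides (+ 0) (ℤ.+-inverseʳ a))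

mod-trans : ∀ {m a b c} → Congruent m a b → Congruent m b c → Congruent m a c
mod-trans {m} {a} {b} {c} (congruent m∣a-b) (congruent m∣b-c) =
  congruent (subst (m Signed.∣_) (telescope a b c) (Signed.∣m∣n⇒∣m+n m∣a-b m∣b-c))
  where
  telescope : ∀ a b c → (a ℤ.- b) ℤ.+ (b ℤ.- c) ≡ a ℤ.- c
  telescope = solve-∀

mod-*ˡ : ∀ {m a b} c → Congruent m a b → Congruent m (c ℤ.* a) (c ℤ.* b)
mod-*ˡ {m} {a} {b} c (congruent m∣a-b) =
  congruent (subst (m Signed.∣_) (distrib c a b) (Signed.∣n⇒∣m*n c m∣a-b))
  where
  distrib : ∀ c a b → c ℤ.* (a ℤ.- b) ≡ c ℤ.* a ℤ.- c ℤ.* b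
  distrib = solve-∀

mod-neg : ∀ {m a b} → Congruent m a b → Congruent m (- a) (- b)
mod-neg {m} {a} {b} (congruent m∣a-b) =
  congruent (subst (m Signed.∣_) (distrib a b) (Signed.∣m⇒∣-m m∣a-b))
  where
  distrib : ∀ a b → - (a ℤ.- b) ≡ - a ℤ.- - b
  distrib = solve-∀

-- Periodicity of derangement numbers:  S_{k+m} ≡ (-1)^m S_k (mod m).
-- Induction on k; the recurrence gives
--   S_{k+1+m} - (-1)^m S_{k+1} = (k+1) (S_{k+m} - (-1)^m S_k) + m S_{k+m}.
S-period : ∀ m k → Congruent (+ m) (S (k + m)) (sign m ℤ.* S k)
S-period zero    zero = mod-reflexive refl
S-period (suc m) zero = congruent (subst (+ suc m Signed.∣_) (sym difference-is-multiple)
                                         (Signed.∣m⇒∣m*n (S m) Signed.∣-refl))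
  where
  cancel : ∀ a x s → a ℤ.* x ℤ.+ s ℤ.- s ℤ.* + 1 ≡ a ℤ.* x
  cancel = solve-∀
  difference-is-multiple : S (suc m) ℤ.- sign (suc m) ℤ.* + 1 ≡ + suc m ℤ.* S m
  difference-is-multiple =
    trans (cong (ℤ._- sign (suc m) ℤ.* + 1) (S-suc m)) (cancel (+ suc m) (S m) (sign (suc m)))
S-period m (suc k) = congruent (subst (+ m Signed.∣_) (sym difference-split)
  (Signed.∣m∣n⇒∣m+n (Signed.∣n⇒∣m*n (+ suc k) (difference (S-period m k)))
                    (Signed.∣m⇒∣m*n (S (k + m)) Signed.∣-refl)))
  where
  regroup : ∀ A M T s σ Sk →
    (A ℤ.+ M) ℤ.* T ℤ.+ σ ℤ.* s ℤ.- s ℤ.* (A ℤ.* Sk ℤ.+ σ) ≡ A ℤ.* (T ℤ.- s ℤ.* Sk) ℤ.+ M ℤ.* T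
  regroup = solve-∀
  difference-split : S (suc k + m) ℤ.- sign m ℤ.* S (suc k)
                   ≡ + suc k ℤ.* (S (k + m) ℤ.- sign m ℤ.* S k) ℤ.+ + m ℤ.* S (k + m)
  difference-split = begin
    S (suc k + m) ℤ.- sign m ℤ.* S (suc k)
      ≡⟨ cong₂ (λ u v → u ℤ.- sign m ℤ.* v) (S-suc (k + m)) (S-suc k) ⟩
    + suc (k + m) ℤ.* S (k + m) ℤ.+ sign (suc k + m) ℤ.- sign m ℤ.* (+ suc k ℤ.* S k ℤ.+ sign (suc k))
      ≡⟨ cong₂ (λ u v → u ℤ.* S (k + m) ℤ.+ v ℤ.- sign m ℤ.* (+ suc k ℤ.* S k ℤ.+ sign (suc k)))
               (ℤ.pos-+ (suc k) m) (sign-+ (suc k) m) ⟩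
    (+ suc k ℤ.+ + m) ℤ.* S (k + m) ℤ.+ sign (suc k) ℤ.* sign m ℤ.- sign m ℤ.* (+ suc k ℤ.* S k ℤ.+ sign (suc k))
      ≡⟨ regroup (+ suc k) (+ m) (S (k + m)) (sign m) (sign (suc k)) (S k) ⟩
    + suc k ℤ.* (S (k + m) ℤ.- sign m ℤ.* S k) ℤ.+ + m ℤ.* S (k + m) ∎

S-period* : ∀ m k j → Congruent (+ m) (S (k + j * m)) (sign (j * m) ℤ.* S k)
S-period* m k zero =
  mod-reflexive (trans (cong S (+-identityʳ k)) (sym (ℤ.*-identityˡ (S k))))
S-period* m k (suc j) =
  mod-trans (mod-reflexive (cong S reassociate))
  (mod-trans (S-period m (k + j * m))
  (mod-trans (mod-*ˡ (sign m) (S-period* m k j))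
             (mod-reflexive combine-signs)))
  where
  reassociate : k + (m + j * m) ≡ k + j * m + m
  reassociate = trans (cong (λ x → k + x) (+-comm m (j * m))) (sym (+-assoc k (j * m) m))
  combine-signs : sign m ℤ.* (sign (j * m) ℤ.* S k) ≡ sign (m + j * m) ℤ.* S k
  combine-signs = trans (sym (ℤ.*-assoc (sign m) (sign (j * m)) (S k)))
                        (cong (ℤ._* S k) (sym (sign-+ m (j * m))))

S-at-multiple : ∀ m j .{{_ : NonZero m}} → Congruent (+ m) (S (suc j * m ∸ 1)) (sign (j * m) ℤ.* S (m ∸ 1))
S-at-multiple (suc m) j = S-period* (suc m) m j

S-even-divisor : ∀ {m n} .{{_ : NonZero m}} .{{_ : NonZero n}} → m ∣ n → 2 ∣ m →
                 Congruent (+ m) (S (n ∸ 1)) (S (m ∸ 1))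
S-even-divisor {m} (divides (suc j) refl) 2∣m =
  mod-trans (S-at-multiple m j)
            (mod-reflexive (trans (cong (ℤ._* S (m ∸ 1)) (sign-even (∣n⇒∣m*n j 2∣m)))
                                  (ℤ.*-identityˡ (S (m ∸ 1)))))

S-odd-divisor : ∀ {m n} .{{_ : NonZero m}} .{{_ : NonZero n}} → m ∣ n → 2 ∣ n → ¬ 2 ∣ m →
                Congruent (+ m) (S (n ∸ 1)) (- S (m ∸ 1))
S-odd-divisor {m} (divides (suc j) refl) 2∣n 2∤m =
  mod-trans (S-at-multiple m j)
            (mod-reflexive (trans (cong (ℤ._* S (m ∸ 1)) (sign-odd 2∤jm)) (ℤ.-1*i≡-i (S (m ∸ 1)))))
  where
  2∤jm : ¬ 2 ∣ j * m
  2∤jm 2∣jm = 2∤m (∣m+n∣m⇒∣n (subst (2 ∣_) (+-comm m (j * m)) 2∣n) 2∣jm)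

coprime-*ʳ : ∀ {m a b} → Coprime m a → Coprime m b → Coprime m (a * b)
coprime-*ʳ m⊥a m⊥b (d∣m , d∣ab) =
  m⊥b (d∣m , coprime-divisor (λ (c∣d , c∣a) → m⊥a (∣-trans c∣d d∣m , c∣a)) d∣ab)

coprime-^ʳ : ∀ {m a} k → Coprime m a → Coprime m (a ^ k)
coprime-^ʳ zero    _   (_ , d∣1) = ∣1⇒≡1 d∣1
coprime-^ʳ (suc k) m⊥a = coprime-*ʳ m⊥a (coprime-^ʳ k m⊥a)

coprime-^ : ∀ {a b} i j → Coprime a b → Coprime (a ^ i) (b ^ j)
coprime-^ i j a⊥b = Coprime.sym (coprime-^ʳ i (Coprime.sym (coprime-^ʳ j a⊥b)))

primes-coprime : ∀ {p q} → Prime p → Prime q → p ≢ q → Coprime p q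
primes-coprime p-prime q-prime p≢q (d∣p , d∣q) with prime⇒irreducible p-prime d∣p
... | inj₁ d≡1 = d≡1
... | inj₂ refl with prime⇒irreducible q-prime d∣q
...   | inj₁ p≡1 = p≡1
...   | inj₂ p≡q = ⊥-elim (p≢q p≡q)

coprime-prodFin : ∀ {m} l (f : Fin l → ℕ) → (∀ i → Coprime m (f i)) → Coprime m (prodFin l f)
coprime-prodFin zero    f _     (_ , d∣1) = ∣1⇒≡1 d∣1
coprime-prodFin (suc l) f m⊥f = coprime-*ʳ (m⊥f Fin.zero) (coprime-prodFin l (f ∘ Fin.suc) (m⊥f ∘ Fin.suc))

coprime-*-∣ : ∀ {a b N} → Coprime a b → a ∣ N → b ∣ N → a * b ∣ N
coprime-*-∣ {a} {b} a⊥b (divides k refl) b∣ka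
  with coprime-divisor (Coprime.sym a⊥b) (subst (b ∣_) (*-comm k a) b∣ka)
... | divides j refl = divides j (trans (*-assoc j b a) (cong (j *_) (*-comm b a)))

prodFin-∣ : ∀ {N} l (f : Fin l → ℕ) → (∀ i j → i ≢ j → Coprime (f i) (f j)) →
            (∀ i → f i ∣ N) → prodFin l f ∣ N
prodFin-∣ zero    f _        _   = 1∣ _
prodFin-∣ (suc l) f pairwise f∣N =
  coprime-*-∣ (coprime-prodFin l (f ∘ Fin.suc) (λ i → pairwise Fin.zero (Fin.suc i) (λ ())))
              (f∣N Fin.zero)
              (prodFin-∣ l (f ∘ Fin.suc) (λ i j i≢j → pairwise (Fin.suc i) (Fin.suc j) (i≢j ∘ Fin.suc-injective))
                         (f∣N ∘ Fin.suc))

factor-∣ : ∀ l (f : Fin l → ℕ) i → f i ∣ prodFin l f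
factor-∣ (suc l) f Fin.zero    = m∣m*n (prodFin l (f ∘ Fin.suc))
factor-∣ (suc l) f (Fin.suc i) = ∣n⇒∣m*n (f Fin.zero) (factor-∣ l (f ∘ Fin.suc) i)

prodFin-nonZero : ∀ l (f : Fin l → ℕ) → (∀ i → NonZero (f i)) → NonZero (prodFin l f)
prodFin-nonZero zero    f _  = _
prodFin-nonZero (suc l) f nz =
  m*n≢0 (f Fin.zero) (prodFin l (f ∘ Fin.suc)) {{nz Fin.zero}} {{prodFin-nonZero l (f ∘ Fin.suc) (nz ∘ Fin.suc)}}

∣-^ : ∀ p {e} → 1 ≤ e → p ∣ p ^ e
∣-^ p {suc e} _ = m∣m*n (p ^ e)

corollary3 : (n e l : ℕ) (q es : Fin l → ℕ) (r : ℤ)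
    → 1 ≤ e
    → (∀ i → Prime (q i))
    → (∀ i → ¬ (2 ∣ q i))
    → Injective _≡_ _≡_ q
    → (∀ i → 1 ≤ es i)
    → n ≡ 2 ^ e * prodFin l (λ i → q i ^ es i)
    → S (2 ^ e ∸ 1) ≡ r [mod + (2 ^ e) ]
    → (∀ i → S (q i ^ es i ∸ 1) ≡ - r [mod + (q i ^ es i) ])
    → S (n ∸ 1) ≡ r [mod + n ]
corollary3 _ e l q es r 1≤e q-prime q-odd q-injective _ refl S₂≡r Sq≡-r =
  coprime-*-∣ 2ᵉ⊥P (toMod two-power-part) (prodFin-∣ l qᵉ qᵉ-pairwise-coprime (toMod ∘ odd-part))
  where
  qᵉ : Fin l → ℕ
  qᵉ i = q i ^ es i
  P : ℕ
  P = prodFin l qᵉ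
  n : ℕ
  n = 2 ^ e * P

  qᵉ≢0 : ∀ i → NonZero (qᵉ i)
  qᵉ≢0 i = m^n≢0 (q i) (es i) {{prime⇒nonZero (q-prime i)}}
  instance
    2ᵉ≢0 : NonZero (2 ^ e)
    2ᵉ≢0 = m^n≢0 2 e
    n≢0 : NonZero n
    n≢0 = m*n≢0 (2 ^ e) P {{2ᵉ≢0}} {{prodFin-nonZero l qᵉ qᵉ≢0}}

  2⊥q : ∀ i → Coprime 2 (q i)
  2⊥q i = primes-coprime prime[2] (q-prime i) (λ 2≡q → q-odd i (subst (2 ∣_) 2≡q ∣-refl))
  2∤qᵉ : ∀ i → ¬ 2 ∣ qᵉ i
  2∤qᵉ i 2∣qᵉ with coprime-^ʳ (es i) (2⊥q i) (∣-refl , 2∣qᵉ)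
  ... | ()
  2ᵉ⊥P : Coprime (2 ^ e) P
  2ᵉ⊥P = coprime-prodFin l qᵉ (λ i → coprime-^ e (es i) (2⊥q i))
  qᵉ-pairwise-coprime : ∀ i j → i ≢ j → Coprime (qᵉ i) (qᵉ j)
  qᵉ-pairwise-coprime i j i≢j =
    coprime-^ (es i) (es j) (primes-coprime (q-prime i) (q-prime j) (i≢j ∘ q-injective))

  two-power-part : Congruent (+ (2 ^ e)) (S (n ∸ 1)) r
  two-power-part = mod-trans (S-even-divisor (m∣m*n P) (∣-^ 2 1≤e)) (fromMod _ _ _ S₂≡r)

  odd-part : ∀ i → Congruent (+ qᵉ i) (S (n ∸ 1)) r
  odd-part i =
    mod-trans (S-odd-divisor {{qᵉ≢0 i}} (∣n⇒∣m*n (2 ^ e) (factor-∣ l qᵉ i)) (∣m⇒∣m*n P (∣-^ 2 1≤e)) (2∤qᵉ i))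
              (mod-trans (mod-neg (fromMod _ _ _ (Sq≡-r i))) (mod-reflexive (ℤ.neg-involutive r)))
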